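{- Let $G=(V,E)$ be an undirected graph with a partition of $V$ into classes such that any two vertices in the same class have the same type (the classes are called types), and let $P=\{(s_i,t_i)\}$ be a set of pairs of vertices of $G$. Then there exist $|P|$ mutually vertex-disjoint paths $p_i$, with $p_i$ joining $s_i$ and $t_i$, if and only if there exist such $|P|$ mutually vertex-disjoint paths that moreover form a simple solution, i.e. each path $p_i$ contains at most one non-endpoint vertex of every type.
   Context: Two vertices $v,v'$ of a graph $G$ have the same type iff $N(v)\setminus\{v'\}=N(v')\setminus\{v\}$, where $N(v)$ denotes the neighborhood of $v$. A solution to the p-Vertex-Disjoint Paths instance $(G,P)$ is a family of mutually vertex-disjoint paths $p_i$ between $s_i$ and $t_i$, one for each pair in $P$; it is simple if each path contains at most a single non-endpoint vertex of every type (class of the partition). -}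

module Defs where

open import Data.Nat using (ℕ)
open import Data.Fin using (Fin)
open import Data.List using (List; []; _∷_; [_])
open import Data.List.Membership.Propositional using (_∈_)
open import Data.List.Relation.Unary.Unique.Propositional using (Unique)
open import Data.Product using (Σ; _×_; proj₁; proj₂)
open import Data.Empty using (⊥)
open import Relation.Nullary using (¬_)
open import Relation.Binary.PropositionalEquality using (_≡_; _≢_)

record Graph (n : ℕ) : Set₁ where
  field
    Adj    : Fin n → Fin n → Set
    sym    : ∀ {u v} → Adj u v → Adj v u
    irrefl : ∀ {v} → ¬ Adj v v
open Graph public

module _ {n : ℕ} (G : Graph n) where

  SameType : Fin n → Fin n → Set
  SameType v v' =
    (∀ x → Adj G v x × x ≢ v' → Adj G v' x × x ≢ v) ×
    (∀ x → Adj G v' x × x ≢ v → Adj G v x × x ≢ v')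

  data Walk : Fin n → Fin n → List (Fin n) → Set where
    single : ∀ v → Walk v v [ v ]
    step   : ∀ {u v w vs} → Adj G u v → Walk v w vs → Walk u w (u ∷ vs)

  IsPath : Fin n → Fin n → List (Fin n) → Set
  IsPath s t vs = Walk s t vs × Unique vs

  IsSolution : {m : ℕ} → (Fin m → Fin n × Fin n) → (Fin m → List (Fin n)) → Set
  IsSolution {m} P p =
    (∀ i → IsPath (proj₁ (P i)) (proj₂ (P i)) (p i)) ×
    (∀ i j → i ≢ j → ∀ v → v ∈ p i → v ∈ p j → ⊥)

  Internal : Fin n → Fin n → Fin n → List (Fin n) → Set
  Internal s t u vs = u ∈ vs × u ≢ s × u ≢ t

  IsSimple : {m k : ℕ} → (Fin n → Fin k) → (Fin m → Fin n × Fin n) → (Fin m → List (Fin n)) → Set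
  IsSimple cls P p =
    ∀ i u w → Internal (proj₁ (P i)) (proj₂ (P i)) u (p i) →
              Internal (proj₁ (P i)) (proj₂ (P i)) w (p i) →
              cls u ≡ cls w → u ≡ w

-- Each path is simplified on its own, using only its own vertices, so disjointness
-- is preserved. Simplify a path x y … t recursively: first make the part from y
-- simple. If some later non-target vertex z has the type of y, then x, being
-- adjacent to y and distinct from z, is also adjacent to z, and jumping from x
-- straight to the first such z leaves a path whose internal vertices are internal
-- vertices of the simple path from y. Otherwise y is the only internal vertex of
-- its type, so prepending x keeps the path simple.
module Submission where

open import Defs hiding (sym)
open import Data.Nat using (ℕ)
open import Data.Fin using (Fin; _≟_)
open import Data.List using (List; []; _∷_; [_])
open import Data.List.Membership.Propositional using (_∈_)
open import Data.List.Relation.Unary.Any using (here; there)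
import Data.List.Relation.Unary.Any as Any
open import Data.List.Relation.Unary.All using (All; []; _∷_)
import Data.List.Relation.Unary.All as All
open import Data.List.Relation.Unary.All.Properties using (anti-mono)
open import Data.List.Relation.Unary.AllPairs using ([]; _∷_)
open import Data.List.Relation.Unary.Unique.Propositional using (Unique)
open import Data.List.Relation.Binary.Subset.Propositional using (_⊆_)
open import Data.List.Relation.Binary.Subset.Propositional.Properties
  using (⊆-refl; ⊆-trans; xs⊆x∷xs; ∷⁺ʳ)
open import Data.Product using (Σ; Σ-syntax; ∃-syntax; _×_; _,_; proj₁; proj₂)
open import Data.Sum using (_⊎_; inj₁; inj₂)
open import Data.Empty using (⊥-elim)
open import Function using (_∘_)
open import Function.Bundles using (_⇔_; mk⇔)
open import Relation.Nullary using (yes; no)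
open import Relation.Unary using (Pred; Decidable; ∁)
open import Relation.Binary.PropositionalEquality using (_≡_; _≢_; refl; sym; trans; cong)
open import Level using (0ℓ)

module Subpaths {n : ℕ} (G : Graph n) where

  record Subpath (s t : Fin n) (vs : List (Fin n)) : Set where
    constructor subpath
    field
      rest   : List (Fin n)
      walk   : Walk G s t (s ∷ rest)
      unique : Unique (s ∷ rest)
      within : s ∷ rest ⊆ vs

    vertices : List (Fin n)
    vertices = s ∷ rest

  open Subpath public

  widen : ∀ {s t vs ws} → vs ⊆ ws → Subpath s t vs → Subpath s t ws
  widen vs⊆ws (subpath r w uq sub) = subpath r w uq (⊆-trans sub vs⊆ws)

  find-suffix : ∀ {D : Pred (Fin n) 0ℓ} {s t vs} → Decidable D → Walk G s t vs → Unique vs →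
                All (∁ D) vs ⊎ ∃[ z ] D z × Subpath z t vs
  find-suffix D? (single v) uq with D? v
  ... | yes d  = inj₂ (v , d , subpath [] (single v) uq ⊆-refl)
  ... | no ¬d  = inj₁ (¬d ∷ [])
  find-suffix D? (step {u} a w) uq@(_ ∷ uq′) with D? u
  ... | yes d  = inj₂ (u , d , subpath _ (step a w) uq ⊆-refl)
  ... | no ¬d  with find-suffix D? w uq′
  ...   | inj₁ none          = inj₁ (¬d ∷ none)
  ...   | inj₂ (z , d , sp)  = inj₂ (z , d , widen (xs⊆x∷xs _ u) sp)

  find-suffix-after-head : ∀ {D : Pred (Fin n) 0ℓ} {s t r} → Decidable D →
                           Walk G s t (s ∷ r) → Unique (s ∷ r) →
                           All (∁ D) r ⊎ ∃[ z ] D z × Subpath z t r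
  find-suffix-after-head D? (single _) _          = inj₁ []
  find-suffix-after-head D? (step _ w) (_ ∷ uq)  = find-suffix D? w uq

  adj-sameType : ∀ {x y z} → SameType G y z → Adj G x y → x ≢ z → Adj G x z
  adj-sameType (y→z , _) xy x≢z = Graph.sym G (proj₁ (y→z _ (Graph.sym G xy , x≢z)))

module Simplification {n k : ℕ} (G : Graph n) (cls : Fin n → Fin k)
                      (sameType : ∀ v v′ → cls v ≡ cls v′ → SameType G v v′) where

  open Subpaths G

  Simple : Fin n → Fin n → List (Fin n) → Set
  Simple s t vs = ∀ u w → Internal G s t u vs → Internal G s t w vs → cls u ≡ cls w → u ≡ w

  SimpleSubpath : Fin n → Fin n → List (Fin n) → Set
  SimpleSubpath s t vs = Σ[ sp ∈ Subpath s t vs ] Simple s t (vertices sp)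

  simple-single : ∀ v → Simple v v [ v ]
  simple-single v u w (here u≡v , u≢v , _) _ _ = ⊥-elim (u≢v u≡v)

  simple-antitone : ∀ {s s′ t t′ vs vs′} →
                    (∀ {u} → Internal G s′ t′ u vs′ → Internal G s t u vs) →
                    Simple s t vs → Simple s′ t′ vs′
  simple-antitone internal⇒ simple u w iu iw = simple u w (internal⇒ iu) (internal⇒ iw)

  SameClassNonTarget : Fin n → Fin n → Pred (Fin n) 0ℓ
  SameClassNonTarget t y z = cls z ≡ cls y × z ≢ t

  sameClassNonTarget? : ∀ t y → Decidable (SameClassNonTarget t y)
  sameClassNonTarget? t y z with cls z ≟ cls y | z ≟ t
  ... | yes c  | yes z≡t  = no (λ (_ , z≢t) → z≢t z≡t)
  ... | yes c  | no z≢t   = yes (c , z≢t)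
  ... | no ¬c  | _        = no (¬c ∘ proj₁)

  internal-cons-split : ∀ {x y t u r} → All (∁ (SameClassNonTarget t y)) r →
                        Internal G x t u (x ∷ y ∷ r) →
                        u ≡ y ⊎ (Internal G y t u (y ∷ r) × cls u ≢ cls y)
  internal-cons-split {y = y} {u = u} none (u∈ , u≢x , u≢t) with u ≟ y | Any.tail u≢x u∈
  ... | yes u≡y  | _          = inj₁ u≡y
  ... | no u≢y   | here u≡y   = ⊥-elim (u≢y u≡y)
  ... | no u≢y   | there u∈r  = inj₂ ((there u∈r , u≢y , u≢t) , λ c → All.lookup none u∈r (c , u≢t))

  simple-cons : ∀ {x y t r} → All (∁ (SameClassNonTarget t y)) r →
                Simple y t (y ∷ r) → Simple x t (x ∷ y ∷ r)
  simple-cons none simple u w iu iw c with internal-cons-split none iu | internal-cons-split none iw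
  ... | inj₁ u≡y         | inj₁ w≡y         = trans u≡y (sym w≡y)
  ... | inj₁ u≡y         | inj₂ (_ , w≁y)   = ⊥-elim (w≁y (trans (sym c) (cong cls u≡y)))
  ... | inj₂ (_ , u≁y)   | inj₁ w≡y         = ⊥-elim (u≁y (trans c (cong cls w≡y)))
  ... | inj₂ (iu′ , _)   | inj₂ (iw′ , _)   = simple u w iu′ iw′ c

  simple-shortcut : ∀ {x y t r zs} → All (y ≢_) r → zs ⊆ r →
                    Simple y t (y ∷ r) → Simple x t (x ∷ zs)
  simple-shortcut y∉r zs⊆r = simple-antitone λ (u∈ , u≢x , u≢t) →
    let u∈r = zs⊆r (Any.tail u≢x u∈) in
    there u∈r , (λ u≡y → All.lookup y∉r u∈r (sym u≡y)) , u≢t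

  extend : ∀ {x y t vs} → Adj G x y → All (x ≢_) vs →
           SimpleSubpath y t vs → SimpleSubpath x t (x ∷ vs)
  extend {x} {y} {t} {vs} xy x∉vs (subpath r w uq@(y∉r ∷ _) sub , simple)
    with find-suffix-after-head (sameClassNonTarget? t y) w uq
  ... | inj₁ none =
    subpath (y ∷ r) (step xy w) (anti-mono sub x∉vs ∷ uq) (∷⁺ʳ _ sub) ,
    simple-cons none simple
  ... | inj₂ (z , (z~y , _) , subpath r′ w′ uq′ sub′) =
    subpath (z ∷ r′) (step xz w′) (anti-mono z∷r′⊆vs x∉vs ∷ uq′) (∷⁺ʳ _ z∷r′⊆vs) ,
    simple-shortcut y∉r sub′ simple
    where
      z∷r′⊆vs : z ∷ r′ ⊆ vs
      z∷r′⊆vs = ⊆-trans sub′ (sub ∘ there)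
      xz : Adj G x z
      xz = adj-sameType (sameType y z (sym z~y)) xy (All.lookup x∉vs (z∷r′⊆vs (here refl)))

  simplify : ∀ {s t vs} → Walk G s t vs → Unique vs → SimpleSubpath s t vs
  simplify (single v) uq         = subpath [] (single v) uq ⊆-refl , simple-single v
  simplify (step xy w) (x∉ ∷ uq) = extend xy x∉ (simplify w uq)

  simplify-solution : ∀ {m} {P : Fin m → Fin n × Fin n} {p} → IsSolution G P p →
                      Σ[ p′ ∈ (Fin m → List (Fin n)) ] IsSolution G P p′ × IsSimple G cls P p′
  simplify-solution {P = P} {p} (paths , disjoint) =
    vertices ∘ subpathOf ,
    ((λ i → walk (subpathOf i) , unique (subpathOf i)) ,
     λ i j i≢j v v∈i v∈j →
       disjoint i j i≢j v (within (subpathOf i) v∈i) (within (subpathOf j) v∈j)) ,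
    proj₂ ∘ simplified
    where
      simplified : ∀ i → SimpleSubpath (proj₁ (P i)) (proj₂ (P i)) (p i)
      simplified i = simplify (proj₁ (paths i)) (proj₂ (paths i))

      subpathOf : ∀ i → Subpath (proj₁ (P i)) (proj₂ (P i)) (p i)
      subpathOf = proj₁ ∘ simplified

lemma1 : ∀ {n k m : ℕ} (G : Graph n) (cls : Fin n → Fin k) →
         (∀ v v' → cls v ≡ cls v' → SameType G v v') →
         (P : Fin m → Fin n × Fin n) →
         (Σ (Fin m → List (Fin n)) λ p → IsSolution G P p) ⇔
         (Σ (Fin m → List (Fin n)) λ p → IsSolution G P p × IsSimple G cls P p)
lemma1 G cls sameType P =
  mk⇔ (Simplification.simplify-solution G cls sameType ∘ proj₂)
      (λ (p , solution , _) → p , solution)
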